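{- If $G$ is an input graph and $G\Rightarrow_{\{r_0,r_1,r_2\}}^*H$, then $H$ has exactly one root node. Moreover, there is no derivation sequence from $G$ that derives the empty graph.
   Context: Label alphabet $\mathcal{L}=(\{\square,\triangle\},\{\square\})$. A graph is $G=(V,E,s,t,l,m,p)$ with finite $V,E$, total $s,t:E\to V$, partial node labelling into $\{\square,\triangle\}$, total edge labelling into $\{\square\}$, partial rootedness $p:V\to\{0,1\}$ ($1$: root). A TLRG has $l,p$ total. Morphisms preserve sources, targets, edge labels, node labels and rootedness where defined in the domain. A rule $\langle L\leftarrow K\rightarrow R\rangle$: TLRGs $L,R$ and a graph $K$ that is a subgraph of both. Application to a TLRG $G$ via injective $g:L\to G$ satisfying the dangling condition (no edge outside $g(L)$ incident to $g(V_L\setminus V_K)$): delete images of $L\setminus K$; make $g_V(v)$ unlabelled / of undefined rootedness when $v\in V_K$ is so in $K$; add disjointly $R\setminus K$; give such $g_V(v)$ label $l_R(v)$ / rootedness $p_R(v)$. $\Rightarrow^*$: zero or more direct derivations (up to isomorphism). Rules (all edges labelled $\square$): $r_0$: $L$ = unrooted node 1 labelled $\square$ with an edge to rooted node 2 labelled $\square$; $K$ = node 1 unlabelled, undefined rootedness; $R$ = node 1 rooted labelled $\square$. $r_1$: as $r_0$ but node 1 in $L$ labelled $\triangle$. $r_2$: $L$ = rooted node 1 labelled $\square$ with edge to unrooted node 2 labelled $\square$; $K$ = nodes 1,2 unlabelled, undefined rootedness, no edges; $R$ = unrooted node 1 labelled $\triangle$ with edge to rooted node 2 labelled $\square$. An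 input graph is a TLRG with exactly one root node in which all nodes and edges are labelled $\square$. -}

module Defs where

open import Data.Nat using (ℕ)
open import Data.Fin using (Fin; zero; suc; _≟_)
open import Data.Bool using (Bool; true; false; T; not; _∧_; _∨_)
open import Data.Maybe using (Maybe; just; nothing)
open import Data.Product using (Σ; _×_; _,_; ∃)
open import Data.Sum using (_⊎_; inj₁; inj₂)
open import Data.Empty using (⊥)
open import Relation.Nullary using (¬_; does)
open import Relation.Binary.PropositionalEquality using (_≡_; _≢_; refl)
open import Function.Bundles using (_↔_; Inverse)
open import Relation.Binary.Construct.Closure.ReflexiveTransitive using (Star)

data NLab : Set where
  sq tri : NLab

data ELab : Set where
  sqE : ELab

-- Graphs: finite node set Fin nV, finite edge set Fin nE,
-- total source/target, partial node labelling, total edge labelling,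
-- partial rootedness (just true = root, just false = non-root).

record Graph : Set where
  field
    nV nE : ℕ
    s t   : Fin nE → Fin nV
    l     : Fin nV → Maybe NLab
    m     : Fin nE → ELab
    p     : Fin nV → Maybe Bool
open Graph public

Defined : {A : Set} → Maybe A → Set
Defined {A} x = Σ A (λ a → x ≡ just a)

IsTLRG : Graph → Set
IsTLRG G = (∀ v → Defined (l G v)) × (∀ v → Defined (p G v))

Injective : {A B : Set} → (A → B) → Set
Injective f = ∀ {x y} → f x ≡ f y → x ≡ y

record Morphism (G H : Graph) : Set where
  field
    fV : Fin (nV G) → Fin (nV H)
    fE : Fin (nE G) → Fin (nE H)
    pres-s : ∀ e → fV (s G e) ≡ s H (fE e)
    pres-t : ∀ e → fV (t G e) ≡ t H (fE e)
    pres-m : ∀ e → m H (fE e) ≡ m G e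
    pres-l : ∀ v a → l G v ≡ just a → l H (fV v) ≡ just a
    pres-p : ∀ v b → p G v ≡ just b → p H (fV v) ≡ just b
open Morphism public

-- injective morphism (used for "K is a subgraph of L / R" and matches)
record InjMorphism (G H : Graph) : Set where
  field
    mor  : Morphism G H
    injV : Injective (fV mor)
    injE : Injective (fE mor)
open InjMorphism public

record Rule : Set where
  field
    L K R  : Graph
    L-tlrg : IsTLRG L
    R-tlrg : IsTLRG R
    incL   : InjMorphism K L
    incR   : InjMorphism K R
open Rule public

anyFin : {n : ℕ} → (Fin n → Bool) → Bool
anyFin {ℕ.zero}  f = false
anyFin {ℕ.suc n} f = f zero ∨ anyFin (λ i → f (suc i))

module Apply (r : Rule) (G : Graph) (g : InjMorphism (L r) G) where
  kLV = fV (mor (incL r))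
  kLE = fE (mor (incL r))
  kRV = fV (mor (incR r))
  kRE = fE (mor (incR r))
  gV  = fV (mor g)
  gE  = fE (mor g)

  inKLV : Fin (nV (L r)) → Bool
  inKLV x = anyFin (λ k → does (kLV k ≟ x))
  inKLE : Fin (nE (L r)) → Bool
  inKLE y = anyFin (λ k → does (kLE k ≟ y))
  inKRV : Fin (nV (R r)) → Bool
  inKRV w = anyFin (λ k → does (kRV k ≟ w))
  inKRE : Fin (nE (R r)) → Bool
  inKRE y = anyFin (λ k → does (kRE k ≟ y))

  Dangling : Set
  Dangling = ∀ (e : Fin (nE G)) → (∀ y → gE y ≢ e) →
               ∀ x → T (not (inKLV x)) → (gV x ≢ s G e) × (gV x ≢ t G e)

  delV : Fin (nV G) → Bool
  delV v = anyFin (λ x → not (inKLV x) ∧ does (gV x ≟ v))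
  delE : Fin (nE G) → Bool
  delE e = anyFin (λ y → not (inKLE y) ∧ does (gE y ≟ e))

  KeptV = Σ (Fin (nV G)) (λ v → T (not (delV v)))
  KeptE = Σ (Fin (nE G)) (λ e → T (not (delE e)))
  NewV  = Σ (Fin (nV (R r))) (λ w → T (not (inKRV w)))
  NewE  = Σ (Fin (nE (R r))) (λ y → T (not (inKRE y)))

  ResV = KeptV ⊎ NewV
  ResE = KeptE ⊎ NewE

  RelG : Fin (nV G) → ResV → Set
  RelG v (inj₁ (v' , _)) = v ≡ v'
  RelG v (inj₂ _)        = ⊥

  -- which result node a node of R corresponds to (K-nodes are glued
  -- to their image g(kL k) in G)
  RelR : Fin (nV (R r)) → ResV → Set
  RelR w (inj₁ (v , _))  = Σ (Fin (nV (K r))) (λ k → kRV k ≡ w × gV (kLV k) ≡ v)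
  RelR w (inj₂ (w' , _)) = w ≡ w'

  -- relabelling of a preserved node: if undefined in K, it gets the
  -- value from R; otherwise it keeps its value in G
  upd : {A : Set} → Maybe A → Maybe A → Maybe A → Maybe A
  upd nothing  old new = new
  upd (just _) old new = old

  record IsResult (H : Graph) : Set where
    field
      φV : ResV ↔ Fin (nV H)
      φE : ResE ↔ Fin (nE H)
    toV = Inverse.to φV
    toE = Inverse.to φE
    field
      s-old : ∀ (e : KeptE) → Σ ResV (λ x → RelG (s G (Data.Product.proj₁ e)) x × s H (toE (inj₁ e)) ≡ toV x)
      t-old : ∀ (e : KeptE) → Σ ResV (λ x → RelG (t G (Data.Product.proj₁ e)) x × t H (toE (inj₁ e)) ≡ toV x)
      s-new : ∀ (y : NewE) → Σ ResV (λ x → RelR (s (R r) (Data.Product.proj₁ y)) x × s H (toE (inj₂ y)) ≡ toV x)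
      t-new : ∀ (y : NewE) → Σ ResV (λ x → RelR (t (R r) (Data.Product.proj₁ y)) x × t H (toE (inj₂ y)) ≡ toV x)
      m-old : ∀ (e : KeptE) → m H (toE (inj₁ e)) ≡ m G (Data.Product.proj₁ e)
      m-new : ∀ (y : NewE) → m H (toE (inj₂ y)) ≡ m (R r) (Data.Product.proj₁ y)
      l-glued : ∀ (v : KeptV) k → gV (kLV k) ≡ Data.Product.proj₁ v →
                  l H (toV (inj₁ v)) ≡ upd (l (K r) k) (l G (Data.Product.proj₁ v)) (l (R r) (kRV k))
      p-glued : ∀ (v : KeptV) k → gV (kLV k) ≡ Data.Product.proj₁ v →
                  p H (toV (inj₁ v)) ≡ upd (p (K r) k) (p G (Data.Product.proj₁ v)) (p (R r) (kRV k))
      l-other : ∀ (v : KeptV) → (∀ k → gV (kLV k) ≢ Data.Product.proj₁ v) →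
                  l H (toV (inj₁ v)) ≡ l G (Data.Product.proj₁ v)
      p-other : ∀ (v : KeptV) → (∀ k → gV (kLV k) ≢ Data.Product.proj₁ v) →
                  p H (toV (inj₁ v)) ≡ p G (Data.Product.proj₁ v)
      l-new : ∀ (w : NewV) → l H (toV (inj₂ w)) ≡ l (R r) (Data.Product.proj₁ w)
      p-new : ∀ (w : NewV) → p H (toV (inj₂ w)) ≡ p (R r) (Data.Product.proj₁ w)

_⇒[_]_ : Graph → Rule → Graph → Set
G ⇒[ r ] H = Σ (InjMorphism (L r) G) (λ g → Apply.Dangling r G g × Apply.IsResult r G g H)

-- Graph isomorphism (for zero-step derivations "up to isomorphism")

record _≅_ (G H : Graph) : Set where
  field
    isoV : Fin (nV G) ↔ Fin (nV H)
    isoE : Fin (nE G) ↔ Fin (nE H)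
  iV = Inverse.to isoV
  iE = Inverse.to isoE
  field
    iso-s : ∀ e → s H (iE e) ≡ iV (s G e)
    iso-t : ∀ e → t H (iE e) ≡ iV (t G e)
    iso-l : ∀ v → l H (iV v) ≡ l G v
    iso-m : ∀ e → m H (iE e) ≡ m G e
    iso-p : ∀ v → p H (iV v) ≡ p G v

private
  e01 : Fin 1 → Fin 2
  e01 _ = zero
  e02 : Fin 1 → Fin 2
  e02 _ = suc zero

Lr01 : NLab → Graph
Lr01 a = record
  { nV = 2 ; nE = 1 ; s = e01 ; t = e02
  ; l = λ { zero → just a ; (suc _) → just sq }
  ; m = λ _ → sqE
  ; p = λ { zero → just false ; (suc _) → just true } }

Kr01 : Graph
Kr01 = record { nV = 1 ; nE = 0 ; s = λ () ; t = λ () ; l = λ _ → nothing ; m = λ () ; p = λ _ → nothing }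

Rr01 : Graph
Rr01 = record { nV = 1 ; nE = 0 ; s = λ () ; t = λ () ; l = λ _ → just sq ; m = λ () ; p = λ _ → just true }

Lr2 : Graph
Lr2 = record
  { nV = 2 ; nE = 1 ; s = e01 ; t = e02
  ; l = λ _ → just sq ; m = λ _ → sqE
  ; p = λ { zero → just true ; (suc _) → just false } }

Kr2 : Graph
Kr2 = record { nV = 2 ; nE = 0 ; s = λ () ; t = λ () ; l = λ _ → nothing ; m = λ () ; p = λ _ → nothing }

Rr2 : Graph
Rr2 = record
  { nV = 2 ; nE = 1 ; s = e01 ; t = e02
  ; l = λ { zero → just tri ; (suc _) → just sq } ; m = λ _ → sqE
  ; p = λ { zero → just false ; (suc _) → just true } }

private
  inj10 : Injective {Fin 1} {Fin 2} (λ _ → zero)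
  inj10 {zero} {zero} _ = refl

  inj11 : Injective {Fin 1} {Fin 1} (λ x → x)
  inj11 eq = eq

  inj22 : Injective {Fin 2} {Fin 2} (λ x → x)
  inj22 eq = eq

  inj0 : {B : Set} → Injective {Fin 0} {B} (λ ())
  inj0 {x = ()}

Lr01-tlrg : ∀ a → IsTLRG (Lr01 a)
Lr01-tlrg a = (λ { zero → a , refl ; (suc zero) → sq , refl })
            , (λ { zero → false , refl ; (suc zero) → true , refl })

Rr01-tlrg : IsTLRG Rr01
Rr01-tlrg = (λ _ → sq , refl) , (λ _ → true , refl)

Lr2-tlrg : IsTLRG Lr2
Lr2-tlrg = (λ _ → sq , refl) , (λ { zero → true , refl ; (suc zero) → false , refl })

Rr2-tlrg : IsTLRG Rr2
Rr2-tlrg = (λ { zero → tri , refl ; (suc zero) → sq , refl })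
         , (λ { zero → false , refl ; (suc zero) → true , refl })

incKL01 : ∀ a → InjMorphism Kr01 (Lr01 a)
incKL01 a = record
  { mor = record { fV = λ _ → zero ; fE = λ () ; pres-s = λ () ; pres-t = λ () ; pres-m = λ ()
                 ; pres-l = λ v b () ; pres-p = λ v b () }
  ; injV = inj10 ; injE = inj0 }

incKR01 : InjMorphism Kr01 Rr01
incKR01 = record
  { mor = record { fV = λ x → x ; fE = λ () ; pres-s = λ () ; pres-t = λ () ; pres-m = λ ()
                 ; pres-l = λ v b () ; pres-p = λ v b () }
  ; injV = inj11 ; injE = inj0 }

incKL2 : InjMorphism Kr2 Lr2
incKL2 = record
  { mor = record { fV = λ x → x ; fE = λ () ; pres-s = λ () ; pres-t = λ () ; pres-m = λ ()
                 ; pres-l = λ v b () ; pres-p = λ v b () }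
  ; injV = inj22 ; injE = inj0 }

incKR2 : InjMorphism Kr2 Rr2
incKR2 = record
  { mor = record { fV = λ x → x ; fE = λ () ; pres-s = λ () ; pres-t = λ () ; pres-m = λ ()
                 ; pres-l = λ v b () ; pres-p = λ v b () }
  ; injV = inj22 ; injE = inj0 }

r0 : Rule
r0 = record { L = Lr01 sq ; K = Kr01 ; R = Rr01 ; L-tlrg = Lr01-tlrg sq ; R-tlrg = Rr01-tlrg
            ; incL = incKL01 sq ; incR = incKR01 }

r1 : Rule
r1 = record { L = Lr01 tri ; K = Kr01 ; R = Rr01 ; L-tlrg = Lr01-tlrg tri ; R-tlrg = Rr01-tlrg
            ; incL = incKL01 tri ; incR = incKR01 }

r2 : Rule
r2 = record { L = Lr2 ; K = Kr2 ; R = Rr2 ; L-tlrg = Lr2-tlrg ; R-tlrg = Rr2-tlrg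
            ; incL = incKL2 ; incR = incKR2 }

data RuleIx : Set where
  i0 i1 i2 : RuleIx

rule : RuleIx → Rule
rule i0 = r0
rule i1 = r1
rule i2 = r2

Step : Graph → Graph → Set
Step G H = Σ RuleIx (λ i → G ⇒[ rule i ] H)

_⇒*_ : Graph → Graph → Set
G ⇒* H = Σ Graph (λ H' → Star Step G H' × H' ≅ H)

IsRoot : (G : Graph) → Fin (nV G) → Set
IsRoot G v = p G v ≡ just true

ExactlyOneRoot : Graph → Set
ExactlyOneRoot G = Σ (Fin (nV G)) (λ v → IsRoot G v × (∀ w → IsRoot G w → w ≡ v))

InputGraph : Graph → Set
InputGraph G = IsTLRG G × ExactlyOneRoot G
             × (∀ v → l G v ≡ just sq) × (∀ e → m G e ≡ sqE)

IsEmptyGraph : Graph → Set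
IsEmptyGraph G = (nV G ≡ 0) × (nE G ≡ 0)

module Submission where

-- Proof idea.  "Exactly one root" is an invariant of the rule set
-- {r0, r1, r2}; every graph with a root has a node, so no derivation can
-- reach the empty graph.
--
-- It then checks, rule by rule, that the
-- unique root of G moves to a single node of H: to the surviving node of
-- the match for r0 / r1, and along the edge for r2.

open import Defs
open import Data.Product using (_×_; Σ; ∃; _,_; proj₁)
open import Relation.Nullary using (¬_; yes; no; does)
open import Data.Nat as ℕ using ()
open import Data.Fin using (Fin; zero; suc; _≟_)
open import Data.Fin.Properties using (any?)
open import Data.Bool using (Bool; true; false; T; not; _∧_)
open import Data.Bool.Properties using (T-irrelevant; T-∧; T-∨)
open import Data.Sum using (inj₁; inj₂)
open import Data.Empty using (⊥; ⊥-elim)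
open import Data.Maybe using (nothing)
open import Relation.Binary.PropositionalEquality
open import Relation.Binary.Construct.Closure.ReflexiveTransitive using (fold)
open import Function.Bundles using (Inverse; Equivalence)
open import Function.Base using (id)

anyFin-intro : ∀ {n} (f : Fin n → Bool) i → T (f i) → T (anyFin f)
anyFin-intro f zero    fi = Equivalence.from T-∨ (inj₁ fi)
anyFin-intro f (suc i) fi = Equivalence.from T-∨ (inj₂ (anyFin-intro (λ j → f (suc j)) i fi))

anyFin-elim : ∀ {n} (f : Fin n → Bool) → T (anyFin f) → ∃ λ i → T (f i)
anyFin-elim {ℕ.zero}  f ()
anyFin-elim {ℕ.suc n} f h with Equivalence.to T-∨ h
... | inj₁ f0   = zero , f0
... | inj₂ rest with anyFin-elim (λ j → f (suc j)) rest
...   | i , fi = suc i , fi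

T-contradiction : ∀ {b} → T b → T (not b) → ⊥
T-contradiction {true}  _ ()
T-contradiction {false} ()

does-≟ : ∀ {n} {x y : Fin n} → T (does (x ≟ y)) → x ≡ y
does-≟ {x = x} {y} h with x ≟ y
... | yes x≡y = x≡y

does-refl : ∀ {n} (x : Fin n) → T (does (x ≟ x))
does-refl x with x ≟ x
... | yes _  = _
... | no x≢x = x≢x refl

-- Membership proofs `T b` are irrelevant, so subset elements are
-- determined by their underlying element.
subset-≡ : ∀ {n} {P : Fin n → Bool} {v v' : Fin n} {a : T (P v)} {b : T (P v')} →
           v ≡ v' → _≡_ {A = Σ (Fin n) (λ u → T (P u))} (v , a) (v' , b)
subset-≡ {a = a} {b} refl = cong (_ ,_) (T-irrelevant a b)

root-nonempty : ∀ H → ExactlyOneRoot H → ¬ nV H ≡ 0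
root-nonempty H (v , _) nV≡0 with subst Fin nV≡0 v
... | ()

≅-root : ∀ {G H} → G ≅ H → ExactlyOneRoot G → ExactlyOneRoot H
≅-root {G} {H} iso (v₀ , root-v₀ , unique) = iV v₀ , trans (iso-p v₀) root-v₀ , unique'
  where
  open _≅_ iso
  unique' : ∀ w → IsRoot H w → w ≡ iV v₀
  unique' w root-w = begin
      w                        ≡⟨ sym to-from ⟩
      iV (Inverse.from isoV w) ≡⟨ cong iV (unique _ root-from) ⟩
      iV v₀                    ∎
    where
    open ≡-Reasoning
    to-from : iV (Inverse.from isoV w) ≡ w
    to-from = Inverse.strictlyInverseˡ isoV w
    root-from : IsRoot G (Inverse.from isoV w)
    root-from = trans (sym (iso-p _)) (trans (cong (p H) to-from) root-w)

module Application (r : Rule) (G H : Graph) (g : InjMorphism (L r) G)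
                   (res : Apply.IsResult r G g H) where
  open Apply r G g public
  open Apply.IsResult res public

  match-root : ∀ x → IsRoot (L r) x → IsRoot G (gV x)
  match-root x = pres-p (mor g) x true

  match-deleted : ∀ x → T (not (inKLV x)) → T (delV (gV x))
  match-deleted x x∉K =
    anyFin-intro _ x (Equivalence.from T-∧ (x∉K , does-refl (gV x)))

  -- The image of a node of K is kept: by injectivity of g the only node
  -- of L sent to it is the K-node itself.
  glued-kept : ∀ k → T (not (delV (gV (kLV k))))
  glued-kept k with delV (gV (kLV k)) in deleted
  ... | false = _
  ... | true with anyFin-elim (λ x → not (inKLV x) ∧ does (gV x ≟ gV (kLV k))) (subst T (sym deleted) _)
  ...   | x , hit with Equivalence.to T-∧ hit
  ...     | x∉K , gx≡gk = T-contradiction (anyFin-intro _ k (does-refl (kLV k))) k∉K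
    where
    k∉K : T (not (inKLV (kLV k)))
    k∉K = subst (λ y → T (not (inKLV y))) (injV g (does-≟ gx≡gk)) x∉K

  kept-≡ : ∀ {v v' : KeptV} → proj₁ v ≡ proj₁ v' → toV (inj₁ v) ≡ toV (inj₁ v')
  kept-≡ v≡v' = cong (λ u → toV (inj₁ u)) (subset-≡ v≡v')

  data NodeView : Fin (nV H) → Set where
    glued     : (v : KeptV) (k : Fin (nV (K r))) → gV (kLV k) ≡ proj₁ v → NodeView (toV (inj₁ v))
    untouched : (v : KeptV) → (∀ k → gV (kLV k) ≢ proj₁ v) → NodeView (toV (inj₁ v))
    new       : (w : NewV) → NodeView (toV (inj₂ w))

  nodeView : ∀ w → NodeView w
  nodeView w = subst NodeView (Inverse.strictlyInverseˡ φV w) (view (Inverse.from φV w))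
    where
    view : ∀ x → NodeView (toV x)
    view (inj₂ w') = new w'
    view (inj₁ v) with any? (λ k → gV (kLV k) ≟ proj₁ v)
    ... | yes (k , e) = glued v k e
    ... | no  ¬glued  = untouched v (λ k e → ¬glued (k , e))

  untouched-root : ∀ v → (∀ k → gV (kLV k) ≢ proj₁ v) →
                   IsRoot H (toV (inj₁ v)) → IsRoot G (proj₁ v)
  untouched-root v outside root-v = trans (sym (p-other v outside)) root-v

  glued-p : ∀ v k → gV (kLV k) ≡ proj₁ v → p (K r) k ≡ nothing →
            p H (toV (inj₁ v)) ≡ p (R r) (kRV k)
  glued-p v k e undefined rewrite p-glued v k e | undefined = refl

-- r0 and r1 differ only in the label of node 1 of L, so they are treated
-- uniformly.  They move the root from node 2 of the match to node 1 and
-- delete node 2.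
r01 : NLab → Rule
r01 a = record { L = Lr01 a ; K = Kr01 ; R = Rr01 ; L-tlrg = Lr01-tlrg a ; R-tlrg = Rr01-tlrg
               ; incL = incKL01 a ; incR = incKR01 }

r01-preserves : ∀ a {G H} → G ⇒[ r01 a ] H → ExactlyOneRoot G → ExactlyOneRoot H
r01-preserves a {G} {H} (g , _ , res) (v₀ , _ , unique) = ρ , root-ρ , unique'
  where
  open Application (r01 a) G H g res
  node1 : KeptV
  node1 = gV zero , glued-kept zero
  ρ : Fin (nV H)
  ρ = toV (inj₁ node1)
  root-ρ : IsRoot H ρ
  root-ρ = glued-p node1 zero refl refl
  -- The old root is the image of node 2, which is deleted.
  old-root-deleted : T (delV v₀)
  old-root-deleted = subst (λ u → T (delV u)) (unique _ (match-root (suc zero) refl))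
                           (match-deleted (suc zero) _)
  unique' : ∀ w → IsRoot H w → w ≡ ρ
  unique' w root-w with nodeView w
  ... | glued v zero e      = kept-≡ (sym e)
  ... | untouched (v , kept) outside =
          ⊥-elim (T-contradiction old-root-deleted
                   (subst (λ u → T (not (delV u))) (unique v (untouched-root _ outside root-w)) kept))
  ... | new (zero , ())

-- Rule r2 moves the root along an edge from node 1 to node 2, which
-- both survive; node 1 becomes unrooted.
r2-preserves : ∀ {G H} → G ⇒[ r2 ] H → ExactlyOneRoot G → ExactlyOneRoot H
r2-preserves {G} {H} (g , _ , res) (v₀ , _ , unique) = ρ , root-ρ , unique'
  where
  open Application r2 G H g res
  node2 : KeptV
  node2 = gV (suc zero) , glued-kept (suc zero)
  ρ : Fin (nV H)
  ρ = toV (inj₁ node2)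
  root-ρ : IsRoot H ρ
  root-ρ = glued-p node2 (suc zero) refl refl
  -- The old root is the image of node 1, which lies in K.
  old-root-glued : gV zero ≡ v₀
  old-root-glued = unique _ (match-root zero refl)
  unique' : ∀ w → IsRoot H w → w ≡ ρ
  unique' w root-w with nodeView w
  ... | glued v (suc zero) e = kept-≡ (sym e)
  ... | glued v zero e with () ← trans (sym (glued-p v zero e refl)) root-w
  ... | untouched v outside =
          ⊥-elim (outside zero (trans old-root-glued (sym (unique _ (untouched-root v outside root-w)))))
  ... | new (zero , ())
  ... | new (suc zero , ())

step-preserves : ∀ {G H} → Step G H → ExactlyOneRoot G → ExactlyOneRoot H
step-preserves (i0 , d) = r01-preserves sq d
step-preserves (i1 , d) = r01-preserves tri d
step-preserves (i2 , d) = r2-preserves d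

derivation-preserves : ∀ {G H} → G ⇒* H → ExactlyOneRoot G → ExactlyOneRoot H
derivation-preserves (H' , steps , iso) root-G =
  ≅-root iso (fold (λ G H → ExactlyOneRoot G → ExactlyOneRoot H)
                   (λ s rest root → rest (step-preserves s root)) id steps root-G)

mainTheorem10 : (G : Graph) → InputGraph G →
    ((H : Graph) → G ⇒* H → ExactlyOneRoot H) × ((H : Graph) → G ⇒* H → ¬ IsEmptyGraph H)
mainTheorem10 G (_ , root-G , _) = oneRoot , nonempty
  where
  oneRoot : (H : Graph) → G ⇒* H → ExactlyOneRoot H
  oneRoot H d = derivation-preserves d root-G
  nonempty : (H : Graph) → G ⇒* H → ¬ IsEmptyGraph H
  nonempty H d (nV≡0 , _) = root-nonempty H (oneRoot H d) nV≡0
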